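{- Generalized weighted sums are well defined up to $\equiv$: for a non-empty finite index set $I$ and families $\{r_i\}_{i\in I}\subseteq\mathbb S$, $\{e_i\}_{i\in I}\subseteq\mathsf{Exp}$, any two expressions obtained by unrolling $\bigoplus_{i\in I}r_i\cdot e_i$ according to its recursive definition (with arbitrary choices of the element $j$ at each step) are related by $\equiv$.
   Context: Semiring $(\mathbb S,+,\cdot,0,1)$, $0\ne1$, assumed positive, refinement and Conway (with $^*$ satisfying $(a+b)^*=a^*(ba^*)^*$, $(ab)^*=1+a(ba)^*b$). Finite set $T$ of primitive tests; sets $\mathsf{Act}$, $\mathsf{Out}$. Tests $b,c::=\mathbf 0\mid\mathbf 1\mid t\in T\mid\bar b\mid b+c\mid bc$; $\mathsf{At}$ atoms, $\le_{BA}$ entailment. Expressions $e,f::=p\in\mathsf{Act}\mid b\mid e+_bf\mid e;f\mid e^{(b)}\mid v\in\mathsf{Out}\mid e\oplus_{r,s}f$; $\odot r:=\mathbf 1\oplus_{r,0}\mathbf 0$. Generalized weighted sum: for $j\in I$, $\bigoplus_{i\in I}r_i\cdot e_i=e_j\oplus_{r_j,1}\big(\bigoplus_{i\in I\setminus\{j\}}r_i\cdot e_i\big)$, where the sum over the empty index set is $\odot 0$. $E$ and $\equiv$: $E(p)_\alpha=E(v)_\alpha=0$; $E(b)_\alpha=1$ if $\alpha\le_{BA}b$ else $0$; $E(e\oplus_{r,s}f)_\alpha=rE(e)_\alpha+sE(f)_\alpha$; $E(e+_bf)_\alpha=E(e)_\alpha$ if $\alpha\le_{BA}b$ else $E(f)_\alpha$;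 $E(e;f)_\alpha=E(e)_\alpha E(f)_\alpha$; $E(e^{(b)})_\alpha=E(\bar b)_\alpha$. $\equiv$ is the smallest congruence (identifying Boolean-equivalent tests) containing G1 $e+_be\equiv e$; G2 $e+_bf\equiv b;e+_bf$; G3 $e+_bf\equiv f+_{\bar b}e$; G4 $(e+_bf)+_cg\equiv e+_{bc}(f+_cg)$; D1 $e\oplus_{r,s}(f+_bg)\equiv(e\oplus_{r,s}f)+_b(e\oplus_{r,s}g)$; D2 $e\oplus_{r,s}(f\oplus_{t,u}g)\equiv e\oplus_{r,1}(f\oplus_{st,su}g)$; D3 $b;(e\oplus_{r,s}f)\equiv b;(b;e\oplus_{r,s}b;f)$; S1 $\mathbf 1;e\equiv e\equiv e;\mathbf 1$; S2 $(e;f);g\equiv e;(f;g)$; S3 $\mathbf 0;e\equiv\mathbf 0$; S4 $(e\oplus_{r,s}f);g\equiv e;g\oplus_{r,s}f;g$; S5 $(e+_bf);g\equiv e;g+_bf;g$; S6 $v;e\equiv v$; S7 $b;c\equiv bc$; L1 $e^{(b)}\equiv e;e^{(b)}+_b\mathbf 1$; C1 $\odot1\equiv\mathbf 1$; C2 $\odot0;e\equiv\odot0$; W1 $e\oplus_{r,s}e\equiv\odot(r+s);e$; W2 $e\oplus_{r,s}f\equiv f\oplus_{s,r}e$; W3 $e\oplus_{r,s}(f\oplus_{t,u}g)\equiv(e\oplus_{r,st}f)\oplus_{1,su}g$; W4 $e\oplus_{ru,s}f\equiv(\odot u;e)\oplus_{r,s}f$; closed under L2 (from $e\equiv(f\oplus_{r,s}\mathbf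 1)+_cg$ infer $c;e^{(b)}\equiv c;((\odot(s^*r);f;e^{(b)})+_b\mathbf 1)$) and F1 (from $g\equiv e;g+_bf$ and $E(e)_\alpha=0$ for all $\alpha$ infer $g\equiv e^{(b)};f$). -}

module Defs where

open import Data.Nat using (ℕ)
open import Data.Bool using (Bool; true; false; not; _∧_; _∨_; if_then_else_)
open import Data.Fin using (Fin)
open import Data.Fin.Subset using (Subset; _∈_; _-_; ⊥)
open import Data.Product using (∃; _×_)
open import Data.Sum using (_⊎_)
open import Relation.Nullary using (¬_)
open import Relation.Binary.PropositionalEquality using (_≡_)
open import Algebra.Structures using (IsSemiring)

record PRCSemiring : Set₁ where
  infixl 6 _+_
  infixl 7 _·_
  field
    Carrier    : Set
    _+_        : Carrier → Carrier → Carrier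
    _·_        : Carrier → Carrier → Carrier
    0#         : Carrier
    1#         : Carrier
    _⋆         : Carrier → Carrier
    isSemiring : IsSemiring _≡_ _+_ _·_ 0# 1#
    0≢1        : ¬ (0# ≡ 1#)
    zeroSumFree   : ∀ a b → a + b ≡ 0# → (a ≡ 0#) × (b ≡ 0#)
    noZeroDivisor : ∀ a b → a · b ≡ 0# → (a ≡ 0#) ⊎ (b ≡ 0#)
    refinement : ∀ a₁ a₂ b₁ b₂ → a₁ + a₂ ≡ b₁ + b₂ →
      ∃ λ c₁₁ → ∃ λ c₁₂ → ∃ λ c₂₁ → ∃ λ c₂₂ →
        (a₁ ≡ c₁₁ + c₁₂) × (a₂ ≡ c₂₁ + c₂₂) ×
        (b₁ ≡ c₁₁ + c₂₁) × (b₂ ≡ c₁₂ + c₂₂)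
    sumStar  : ∀ a b → (a + b) ⋆ ≡ a ⋆ · (b · a ⋆) ⋆
    prodStar : ∀ a b → (a · b) ⋆ ≡ 1# + a · (b · a) ⋆ · b

module Lang (𝕊 : PRCSemiring) (k : ℕ) (Act Out : Set) where
  open PRCSemiring 𝕊

  T : Set
  T = Fin k

  data Test : Set where
    𝟎 𝟏  : Test
    prim : T → Test
    neg  : Test → Test
    _or_ _and_ : Test → Test → Test

  At : Set
  At = T → Bool

  ⟦_⟧ : Test → At → Bool
  ⟦ 𝟎 ⟧ α = false
  ⟦ 𝟏 ⟧ α = true
  ⟦ prim t ⟧ α = α t
  ⟦ neg b ⟧ α = not (⟦ b ⟧ α)
  ⟦ b or c ⟧ α = ⟦ b ⟧ α ∨ ⟦ c ⟧ α
  ⟦ b and c ⟧ α = ⟦ b ⟧ α ∧ ⟦ c ⟧ α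

  _≤BA_ : At → Test → Set
  α ≤BA b = ⟦ b ⟧ α ≡ true

  _≡BA_ : Test → Test → Set
  b ≡BA c = ∀ α → ⟦ b ⟧ α ≡ ⟦ c ⟧ α

  infixr 5 _+⟨_⟩_
  infixr 6 _⊕[_,_]_
  infixr 7 _︔_
  data Exp : Set where
    act      : Act → Exp
    test     : Test → Exp
    _+⟨_⟩_   : Exp → Test → Exp → Exp
    _︔_      : Exp → Exp → Exp
    loop     : Exp → Test → Exp
    out      : Out → Exp
    _⊕[_,_]_ : Exp → Carrier → Carrier → Exp → Exp

  ⊙_ : Carrier → Exp
  ⊙ r = test 𝟏 ⊕[ r , 0# ] test 𝟎

  𝔼 : Exp → At → Carrier
  𝔼 (act p) α = 0#
  𝔼 (test b) α = if ⟦ b ⟧ α then 1# else 0#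
  𝔼 (e +⟨ b ⟩ f) α = if ⟦ b ⟧ α then 𝔼 e α else 𝔼 f α
  𝔼 (e ︔ f) α = 𝔼 e α · 𝔼 f α
  𝔼 (loop e b) α = 𝔼 (test (neg b)) α
  𝔼 (out v) α = 0#
  𝔼 (e ⊕[ r , s ] f) α = r · 𝔼 e α + s · 𝔼 f α

  infix 4 _≡ₑ_
  data _≡ₑ_ : Exp → Exp → Set where
    ≡-refl  : ∀ {e} → e ≡ₑ e
    ≡-sym   : ∀ {e f} → e ≡ₑ f → f ≡ₑ e
    ≡-trans : ∀ {e f g} → e ≡ₑ f → f ≡ₑ g → e ≡ₑ g
    +-cong  : ∀ {e e′ f f′ b} → e ≡ₑ e′ → f ≡ₑ f′ → e +⟨ b ⟩ f ≡ₑ e′ +⟨ b ⟩ f′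
    ︔-cong  : ∀ {e e′ f f′} → e ≡ₑ e′ → f ≡ₑ f′ → e ︔ f ≡ₑ e′ ︔ f′
    loop-cong : ∀ {e e′ b} → e ≡ₑ e′ → loop e b ≡ₑ loop e′ b
    ⊕-cong  : ∀ {e e′ f f′ r s} → e ≡ₑ e′ → f ≡ₑ f′ → e ⊕[ r , s ] f ≡ₑ e′ ⊕[ r , s ] f′
    test-BA : ∀ {b c} → b ≡BA c → test b ≡ₑ test c
    +-BA    : ∀ {e f b c} → b ≡BA c → e +⟨ b ⟩ f ≡ₑ e +⟨ c ⟩ f
    loop-BA : ∀ {e b c} → b ≡BA c → loop e b ≡ₑ loop e c
    G1 : ∀ {e b} → e +⟨ b ⟩ e ≡ₑ e
    G2 : ∀ {e f b} → e +⟨ b ⟩ f ≡ₑ (test b ︔ e) +⟨ b ⟩ f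
    G3 : ∀ {e f b} → e +⟨ b ⟩ f ≡ₑ f +⟨ neg b ⟩ e
    G4 : ∀ {e f g b c} → (e +⟨ b ⟩ f) +⟨ c ⟩ g ≡ₑ e +⟨ b and c ⟩ (f +⟨ c ⟩ g)
    D1 : ∀ {e f g r s b} → e ⊕[ r , s ] (f +⟨ b ⟩ g) ≡ₑ (e ⊕[ r , s ] f) +⟨ b ⟩ (e ⊕[ r , s ] g)
    D2 : ∀ {e f g r s t u} → e ⊕[ r , s ] (f ⊕[ t , u ] g) ≡ₑ e ⊕[ r , 1# ] (f ⊕[ s · t , s · u ] g)
    D3 : ∀ {e f r s b} → test b ︔ (e ⊕[ r , s ] f) ≡ₑ test b ︔ ((test b ︔ e) ⊕[ r , s ] (test b ︔ f))
    S1ˡ : ∀ {e} → test 𝟏 ︔ e ≡ₑ e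
    S1ʳ : ∀ {e} → e ≡ₑ e ︔ test 𝟏
    S2 : ∀ {e f g} → (e ︔ f) ︔ g ≡ₑ e ︔ (f ︔ g)
    S3 : ∀ {e} → test 𝟎 ︔ e ≡ₑ test 𝟎
    S4 : ∀ {e f g r s} → (e ⊕[ r , s ] f) ︔ g ≡ₑ (e ︔ g) ⊕[ r , s ] (f ︔ g)
    S5 : ∀ {e f g b} → (e +⟨ b ⟩ f) ︔ g ≡ₑ (e ︔ g) +⟨ b ⟩ (f ︔ g)
    S6 : ∀ {v e} → out v ︔ e ≡ₑ out v
    S7 : ∀ {b c} → test b ︔ test c ≡ₑ test (b and c)
    L1 : ∀ {e b} → loop e b ≡ₑ (e ︔ loop e b) +⟨ b ⟩ test 𝟏
    C1 : ⊙ 1# ≡ₑ test 𝟏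
    C2 : ∀ {e} → (⊙ 0#) ︔ e ≡ₑ ⊙ 0#
    W1 : ∀ {e r s} → e ⊕[ r , s ] e ≡ₑ (⊙ (r + s)) ︔ e
    W2 : ∀ {e f r s} → e ⊕[ r , s ] f ≡ₑ f ⊕[ s , r ] e
    W3 : ∀ {e f g r s t u} → e ⊕[ r , s ] (f ⊕[ t , u ] g) ≡ₑ (e ⊕[ r , s · t ] f) ⊕[ 1# , s · u ] g
    W4 : ∀ {e f r s u} → e ⊕[ r · u , s ] f ≡ₑ ((⊙ u) ︔ e) ⊕[ r , s ] f
    L2 : ∀ {e f g r s b c} → e ≡ₑ (f ⊕[ r , s ] test 𝟏) +⟨ c ⟩ g →
         test c ︔ loop e b ≡ₑ test c ︔ (((⊙ ((s ⋆) · r)) ︔ f ︔ loop e b) +⟨ b ⟩ test 𝟏)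
    F1 : ∀ {e f g b} → g ≡ₑ (e ︔ g) +⟨ b ⟩ f → (∀ α → 𝔼 e α ≡ 0#) → g ≡ₑ loop e b ︔ f

  -- Unrollings of the generalized weighted sum ⨁_{i ∈ I} r_i · e_i over a
  -- finite index set I ⊆ Fin n:  Unrolling r e I x  means that x is one of
  -- the expressions obtained by unrolling the recursive definition.
  data Unrolling {n : ℕ} (r : Fin n → Carrier) (e : Fin n → Exp) :
                 Subset n → Exp → Set where
    unroll-∅    : Unrolling r e ⊥ (⊙ 0#)
    unroll-pick : ∀ {I x} (j : Fin n) → j ∈ I → Unrolling r e (I - j) x →
                  Unrolling r e I (e j ⊕[ r j , 1# ] x)

-- An unrolling picks some j ∈ I first and then unrolls I - j.  Any other
-- unrolling of I can itself be rearranged to pick j first, because two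
-- consecutive picks commute:  a ⊕[r,1] (b ⊕[s,1] c) ≡ b ⊕[s,1] (a ⊕[r,1] c)
-- follows from W3 and W2.  Induction on the first unrolling then matches the
-- two expressions pick by pick.
module Submission where

open import Defs
open import Data.Nat using (ℕ)
open import Data.Fin using (Fin; _≟_)
open import Data.Fin.Subset using (Subset; Nonempty; _-_; ⁅_⁆; _∈_)
open import Data.Fin.Subset.Properties using (∉⊥; x∈p∧x∉q⇒x∈p─q; x≢y⇒x∉⁅y⁆; p─q─r≡p─r─q)
open import Data.Product using (∃; _×_; _,_)
open import Data.Empty using (⊥-elim)
open import Relation.Nullary using (yes; no)
open import Relation.Binary.Bundles using (Setoid)
open import Relation.Binary.Structures using (IsEquivalence)
open import Relation.Binary.PropositionalEquality using (_≡_; refl; sym; cong; subst)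
import Relation.Binary.Reasoning.Setoid as SetoidReasoning
open import Algebra.Structures using (IsSemiring)

module WeightedSums (𝕊 : PRCSemiring) (k : ℕ) (Act Out : Set) where
  open PRCSemiring 𝕊
  open IsSemiring isSemiring using (*-identityˡ)
  open Lang 𝕊 k Act Out

  ≡ₑ-isEquivalence : IsEquivalence _≡ₑ_
  ≡ₑ-isEquivalence = record { refl = ≡-refl ; sym = ≡-sym ; trans = ≡-trans }

  ≡ₑ-setoid : Setoid _ _
  ≡ₑ-setoid = record { isEquivalence = ≡ₑ-isEquivalence }

  open SetoidReasoning ≡ₑ-setoid

  ≡⇒≡ₑ : ∀ {x y} → x ≡ y → x ≡ₑ y
  ≡⇒≡ₑ refl = ≡-refl

  ⊕₁-exchange : ∀ {a b c r s} →
                a ⊕[ r , 1# ] (b ⊕[ s , 1# ] c) ≡ₑ b ⊕[ s , 1# ] (a ⊕[ r , 1# ] c)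
  ⊕₁-exchange {a} {b} {c} {r} {s} = begin
    a ⊕[ r , 1# ] (b ⊕[ s , 1# ] c)          ≈⟨ W3 ⟩
    (a ⊕[ r , 1# · s ] b) ⊕[ 1# , 1# · 1# ] c ≈⟨ ⊕-cong W2 ≡-refl ⟩
    (b ⊕[ 1# · s , r ] a) ⊕[ 1# , 1# · 1# ] c
      ≈⟨ ≡⇒≡ₑ (cong (λ t → (b ⊕[ t , r ] a) ⊕[ 1# , 1# · 1# ] c) (*-identityˡ s)) ⟩
    (b ⊕[ s , r ] a) ⊕[ 1# , 1# · 1# ] c
      ≈⟨ ≡⇒≡ₑ (cong (λ t → (b ⊕[ s , t ] a) ⊕[ 1# , 1# · 1# ] c) (*-identityˡ r)) ⟨
    (b ⊕[ s , 1# · r ] a) ⊕[ 1# , 1# · 1# ] c ≈⟨ W3 ⟨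
    b ⊕[ s , 1# ] (a ⊕[ r , 1# ] c)          ∎

  module _ {n : ℕ} (r : Fin n → Carrier) (e : Fin n → Exp) where

    unrolling-pick-first : ∀ {I x} j → j ∈ I → Unrolling r e I x →
      ∃ λ x′ → Unrolling r e (I - j) x′ × x ≡ₑ e j ⊕[ r j , 1# ] x′
    unrolling-pick-first j j∈I unroll-∅ = ⊥-elim (∉⊥ j∈I)
    unrolling-pick-first {I} j j∈I (unroll-pick {x = x} m m∈I u) with m ≟ j
    ... | yes refl = x , u , ≡-refl
    ... | no m≢j with unrolling-pick-first j j∈I-m u
      where j∈I-m = x∈p∧x∉q⇒x∈p─q j∈I (x≢y⇒x∉⁅y⁆ (λ j≡m → m≢j (sym j≡m)))
    ... | x′ , u′ , x≡ = e m ⊕[ r m , 1# ] x′ , unroll-pick m m∈I-j u″ ,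
                          ≡-trans (⊕-cong ≡-refl x≡) ⊕₁-exchange
      where
      m∈I-j = x∈p∧x∉q⇒x∈p─q m∈I (x≢y⇒x∉⁅y⁆ m≢j)
      u″ = subst (λ J → Unrolling r e J x′) (p─q─r≡p─r─q I ⁅ m ⁆ ⁅ j ⁆) u′

    unrolling-unique : ∀ {I x y} → Unrolling r e I x → Unrolling r e I y → x ≡ₑ y
    unrolling-unique unroll-∅ unroll-∅ = ≡-refl
    unrolling-unique unroll-∅ (unroll-pick j j∈⊥ _) = ⊥-elim (∉⊥ j∈⊥)
    unrolling-unique (unroll-pick j j∈I u) v with unrolling-pick-first j j∈I v
    ... | y′ , v′ , y≡ = ≡-trans (⊕-cong ≡-refl (unrolling-unique u v′)) (≡-sym y≡)

mainTheorem11 : (𝕊 : PRCSemiring) (k : ℕ) (Act Out : Set) →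
    let open PRCSemiring 𝕊 using (Carrier) in
    let open Lang 𝕊 k Act Out in
    ∀ (n : ℕ) (I : Subset n) → Nonempty I →
    (r : Fin n → Carrier) (e : Fin n → Exp) (x y : Exp) →
    Unrolling r e I x → Unrolling r e I y → x ≡ₑ y
mainTheorem11 𝕊 k Act Out n I _ r e x y =
  WeightedSums.unrolling-unique 𝕊 k Act Out r e
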